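{- Let $n\ge2$, let $E=(S_1,\dots,S_T)$ be a sequence of non-empty hyperedges $S_t\subseteq[n]$, and run the algorithm RAND described in the context on $E$. Fix a step $t\in\{1,\dots,T\}$ and any outcome of RAND's random choices in steps $1,\dots,t-1$. Fix a node $i\in[n]$, and let \[ p=p^{t-1}(i),\qquad \alpha=\frac{2^p-c^{t-1}_{i,p}}{h\cdot 2^p}. \] Probabilities are taken only over RAND's random choices in step $t$. Then at least one of the following holds. (a) $Z^t_i\le Z^{t-1}_i$ for every outcome of the step-$t$ random choices. (b) There is an event $A$, determined by the step-$t$ random choices, with $\Pr[A]=\alpha$ (if $\alpha=0$, take $A=\emptyset$), such that: - $Z^t_i\le Z^{t-1}_i+\frac{1}{4h\cdot2^p}$ for every outcome outside $A$; and - $Z^t_i\le Z^{t-1}_i+\frac{1}{4h\cdot 2^p}-\frac{1}{2h\cdot 2^p\cdot\alpha}$ for every outcome in $A$.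
   Context: Nodes are $[n]$, and $h=\lceil\log_2 n\rceil$. For integers $k\ge0$, let $R_k=\{2^k,\dots,2^{k+1}-1\}$ (so $|R_k|=2^k$) and $q_k=\lceil(1-\tfrac{1}{2n})2^k\rceil$. Algorithm RAND. For each node $i$ it maintains a phase $p(i)$, initially $0$, and for each $k\ge0$ a set $C_{i,k}$, initially empty. When hyperedge $S$ arrives, RAND does the following. - Let $p_S=\min_{i\in S}p(i)$, using the current phases. - Sample $k^*$ uniformly from $\{p_S,\dots,p_S+h-1\}$. - Sample a color $r$ uniformly from $R_{k^*}$, and color $S$ with $r$. - For each $i\in S$: set $C_{i,k^*}\leftarrow C_{i,k^*}\cup\{r\}$; then, if $|C_{i,p(i)}|\ge q_{p(i)}$, set $p(i)\leftarrow p(i)+1$. Analysis variables. - $c_{i,k}=|C_{i,k}|$. - Counters $w_{i,k}$ are initially $0$. In the step in which $S$ arrives, for each $i\in S$ whose phase before the step satisfies $p(i)\le p_S+h-1$, the counter $w_{i,p(i)}$ is incremented by one. No other counter $w$ changes. - For integers $k\ge0$ and $0\le m\le 2^k$, let $d_k(m)=h\sum_{j=1}^{m}\frac{2^k}{2^k-j+1}$. - For each node $i$, let $Z_i=\sum_{k\ge0}\frac{w_{i,k}-2\,d_k(c_{i,k})}{4h\cdot 2^k}$. This is a finite sum, since only finitely many terms are nonzero. The superscript $t$ denotes the value at the end of step $t$, and $t-1$ the value before step $t$. -}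

module Defs where

open import Data.Nat as ℕ using (ℕ; zero; suc; _+_; _*_; _∸_; _^_; _<ᵇ_)
open import Data.Nat.Logarithm using (⌈log₂_⌉)
open import Data.Integer as ℤ using (ℤ; +_)
open import Data.Rational as ℚ using (ℚ; 0ℚ; 1ℚ; 1/_; ceiling; ≢-nonZero)
open import Data.Rational.Properties using () renaming (_≟_ to _≟ℚ_)
open import Data.Fin as Fin using (Fin; toℕ)
open import Data.Fin.Subset using (Subset; ⊥; ⁅_⁆; _∪_; ∣_∣)
open import Data.Vec using (lookup)
open import Data.List using (List; []; _∷_; _++_; map; foldr; allFin; filterᵇ)
open import Data.Bool using (Bool; true; false; if_then_else_; _∧_)
open import Data.Product using (Σ; _,_)
open import Relation.Nullary using (yes; no)
open import Relation.Binary.PropositionalEquality using (_≡_; refl)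

-- 1/d as a rational; the value at d = 0 is an irrelevant junk value 0
-- (it is only ever used with d ≥ 1 when n ≥ 2).
invℕ : ℕ → ℚ
invℕ zero    = 0ℚ
invℕ (suc d) = ℚ._/_ (+ 1) (suc d)

-- 1/x as a rational; junk value 0 at x = 0.
invℚ : ℚ → ℚ
invℚ x with x ≟ℚ 0ℚ
... | yes _ = 0ℚ
... | no x≢0 = 1/_ x {{≢-nonZero x≢0}}

ℕtoℚ : ℕ → ℚ
ℕtoℚ m = ℚ._/_ (+ m) 1

sumBelow : ℕ → (ℕ → ℚ) → ℚ
sumBelow zero    f = 0ℚ
sumBelow (suc K) f = sumBelow K f ℚ.+ f K

module _ (n : ℕ) where

  h : ℕ
  h = ⌈log₂ n ⌉

  q : ℕ → ℤ
  q k = ceiling ((1ℚ ℚ.- invℕ (2 * n)) ℚ.* ℕtoℚ (2 ^ k))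

  -- d_k(m) = h Σ_{j=1}^{m} 2^k / (2^k - j + 1)     (for m ≤ 2^k)
  d : ℕ → ℕ → ℚ
  d k m = ℕtoℚ h ℚ.* sumBelow m (λ j' → ℕtoℚ (2 ^ k) ℚ.* invℕ (suc (2 ^ k ∸ suc j')))
    -- the summand for j = j'+1 is 2^k/(2^k - j + 1) = 2^k / suc (2^k ∸ j)

  -- Colours: the colour set R_k = {2^k, ..., 2^{k+1}-1} is encoded by
  -- Fin (2^k), the element x : Fin (2^k) standing for colour 2^k + x.

  record State : Set where
    field
      phase : Fin n → ℕ
      C     : Fin n → (k : ℕ) → Subset (2 ^ k)
      w     : Fin n → ℕ → ℕ
  open State public

  initState : State
  initState = record { phase = λ _ → 0 ; C = λ _ _ → ⊥ ; w = λ _ _ → 0 }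

  c : State → Fin n → ℕ → ℕ
  c st i k = ∣ C st i k ∣

  Hyperedge : Set
  Hyperedge = Subset n

  _∈ᵇ_ : Fin n → Hyperedge → Bool
  i ∈ᵇ S = lookup S i

  minList : List ℕ → ℕ
  minList []       = 0
  minList (x ∷ []) = x
  minList (x ∷ xs@(_ ∷ _)) = ℕ._⊓_ x (minList xs)

  -- p_S = min_{i ∈ S} p(i)   (S is non-empty in all uses)
  pS : State → Hyperedge → ℕ
  pS st S = minList (map (phase st) (filterᵇ (_∈ᵇ S) (allFin n)))

  -- An outcome of the random choices of one step: k* = p_S + j with
  -- j : Fin h, and the colour r ∈ R_{k*}, encoded as Fin (2^{k*}).
  Outcome : State → Hyperedge → Set
  Outcome st S = Σ (Fin h) (λ j → Fin (2 ^ (pS st S + toℕ j)))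

  kstar : (st : State) (S : Hyperedge) → Outcome st S → ℕ
  kstar st S (j , _) = pS st S + toℕ j

  prob : (st : State) (S : Hyperedge) → Outcome st S → ℚ
  prob st S o = invℕ (h * 2 ^ kstar st S o)

  Pr : (st : State) (S : Hyperedge) → (Outcome st S → Bool) → ℚ
  Pr st S A =
    foldr ℚ._+_ 0ℚ
      (map (λ j → foldr ℚ._+_ 0ℚ
                    (map (λ r → if A (j , r) then prob st S (j , r) else 0ℚ)
                         (allFin (2 ^ (pS st S + toℕ j)))))
           (allFin h))

  addColour : (C₀ : (k : ℕ) → Subset (2 ^ k)) (k* : ℕ) → Fin (2 ^ k*) →
              (k : ℕ) → Subset (2 ^ k)
  addColour C₀ k* r k with k ℕ.≟ k*
  ... | yes refl = C₀ k ∪ ⁅ r ⁆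
  ... | no _     = C₀ k

  next : (st : State) (S : Hyperedge) → Outcome st S → State
  next st S (j , r) = record { phase = newPhase ; C = newC ; w = newW }
    where
      p₀ = pS st S
      k* = p₀ + toℕ j
      newC : Fin n → (k : ℕ) → Subset (2 ^ k)
      newC i = if i ∈ᵇ S then addColour (C st i) k* r else C st i
      newPhase : Fin n → ℕ
      newPhase i =
        if i ∈ᵇ S ∧ ℤ._≤ᵇ_ (q (phase st i)) (+ ∣ newC i (phase st i) ∣)
        then suc (phase st i) else phase st i
      -- w_{i,p(i)} += 1 for i ∈ S with (old) p(i) ≤ p_S + h - 1, i.e. p(i) < p_S + h
      newW : Fin n → ℕ → ℕ
      newW i k =
        if i ∈ᵇ S ∧ (phase st i <ᵇ p₀ + h) ∧ (k ℕ.≡ᵇ phase st i)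
        then suc (w st i k) else w st i k

  data Reachable : List Hyperedge → State → Set where
    init : Reachable [] initState
    step : ∀ {Ss st} → Reachable Ss st → (S : Hyperedge) (o : Outcome st S) →
           Reachable (Ss ++ S ∷ []) (next st S o)

  -- Z_i, with the sum over k truncated to k < K.
  Zupto : ℕ → State → Fin n → ℚ
  Zupto K st i = sumBelow K (λ k →
      (ℕtoℚ (w st i k) ℚ.- (ℕtoℚ 2 ℚ.* d k (c st i k))) ℚ.* invℕ (4 * h * 2 ^ k))

  α : State → Fin n → ℚ
  α st i = (ℕtoℚ (2 ^ phase st i) ℚ.- ℕtoℚ (c st i (phase st i)))
             ℚ.* invℕ (h * 2 ^ phase st i)

{-# OPTIONS --safe #-}

-- In one step only the counter w_{i,p(i)} can grow, by one, adding 1/(4h 2^p) to Z_i, while every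
-- c_{i,k} can only grow and d_k is increasing, so no other term of Z_i increases. If i ∉ S or
-- p(i) ≥ p_S + h, no counter grows at all. Otherwise let A be the event that k* = p(i) and the
-- colour r is not yet in C_{i,p}: it has probability (2^p - c_{i,p})/(h 2^p) = α, and on A the
-- count c_{i,p} grows by one, which lowers the p-th term of Z_i by
-- 2 (d_p(c+1) - d_p(c)) / (4h 2^p) = 1/(2 (2^p - c)) = 1/(2h 2^p α).

module Submission where

open import Defs
open import Data.Nat as ℕ using (ℕ; zero; suc; _+_; _*_; _∸_; _^_; _≤_; _<_; z≤n; s≤s)
import Data.Nat.Properties as ℕP
open import Data.Nat.Coprimality using (1-coprimeTo) renaming (sym to coprime-sym)
open import Data.Nat.Logarithm using (⌈log₂⌉-mono-≤)
open import Data.Integer as ℤ using (+_)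
import Data.Integer.Properties as ℤP
open import Data.Rational as ℚ using (ℚ; 0ℚ; 1ℚ; mkℚ; 1/_; ↥_)
import Data.Rational.Properties as ℚP
open import Data.Rational.Solver using (module +-*-Solver)
open import Data.Fin as Fin using (Fin; toℕ; fromℕ<)
import Data.Fin.Properties as FinP
open import Data.Fin.Subset using (Subset; Nonempty; ∁; _∪_; ⁅_⁆; ∣_∣; _∉_)
open import Data.Fin.Subset.Properties
  using (∣p∣≤n; ∣p∣≤∣p∪q∣; ∣∁p∣≡n∸∣p∣; p⊂q⇒∣p∣<∣q∣; p⊆p∪q; x∈p∪q⁺; x∈⁅x⁆; x∈∁p⇒x∉p)
open import Data.Vec using ([]; _∷_) renaming (lookup to vlookup)
open import Data.Vec.Properties using (lookup⇒[]=)
open import Data.List as List using (List; length; lookup; take; map; foldr; allFin; tabulate)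
import Data.List.Properties as ListP
open import Data.List.Membership.Propositional using () renaming (_∈_ to _∈ₗ_)
open import Data.List.Membership.Propositional.Properties using (∈-map⁺; ∈-filter⁺; ∈-allFin)
open import Data.List.Relation.Unary.All using (All)
open import Data.List.Relation.Unary.Any using (here; there)
open import Data.Bool using (Bool; true; false; T; if_then_else_)
import Data.Bool.Properties as BoolP
open BoolP using (∧-zeroʳ; ¬-not)
open import Data.Product using (Σ; _×_; _,_; proj₂)
open import Data.Sum using (_⊎_; inj₁; inj₂)
open import Data.Empty using (⊥-elim)
open import Relation.Nullary using (Dec; yes; no)
open import Relation.Nullary.Decidable using (T?; dec-true; dec-false)
open import Relation.Binary.PropositionalEquality
open import Function using (_∘_)

open +-*-Solver

ℕtoℚ≡mkℚ : ∀ m → ℕtoℚ m ≡ mkℚ (+ m) 0 (coprime-sym (1-coprimeTo m))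
ℕtoℚ≡mkℚ m = ℚP.normalize-coprime (coprime-sym (1-coprimeTo m))

ℕtoℚ-injective : ∀ {a b} → ℕtoℚ a ≡ ℕtoℚ b → a ≡ b
ℕtoℚ-injective {a} {b} eq =
  ℤP.+-injective (cong ↥_ (trans (sym (ℕtoℚ≡mkℚ a)) (trans eq (ℕtoℚ≡mkℚ b))))

ℕtoℚ-+ : ∀ a b → ℕtoℚ (a + b) ≡ ℕtoℚ a ℚ.+ ℕtoℚ b
ℕtoℚ-+ a b rewrite ℕtoℚ≡mkℚ a | ℕtoℚ≡mkℚ b =
  cong (λ x → ℚ._/_ x 1) (cong₂ ℤ._+_ (sym (ℤP.*-identityʳ (+ a))) (sym (ℤP.*-identityʳ (+ b))))

ℕtoℚ-* : ∀ a b → ℕtoℚ (a * b) ≡ ℕtoℚ a ℚ.* ℕtoℚ b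
ℕtoℚ-* a b rewrite ℕtoℚ≡mkℚ a | ℕtoℚ≡mkℚ b = cong (λ x → ℚ._/_ x 1) (ℤP.pos-* a b)

ℕtoℚ-∸ : ∀ {a b} → b ≤ a → ℕtoℚ (a ∸ b) ≡ ℕtoℚ a ℚ.- ℕtoℚ b
ℕtoℚ-∸ {a} {b} b≤a = begin
  ℕtoℚ (a ∸ b)                           ≡⟨ solve 2 (λ x y → x := x :+ y :- y) refl (ℕtoℚ (a ∸ b)) (ℕtoℚ b) ⟩
  ℕtoℚ (a ∸ b) ℚ.+ ℕtoℚ b ℚ.- ℕtoℚ b     ≡⟨ cong (ℚ._- ℕtoℚ b) (sym (ℕtoℚ-+ (a ∸ b) b)) ⟩
  ℕtoℚ (a ∸ b + b) ℚ.- ℕtoℚ b            ≡⟨ cong (λ x → ℕtoℚ x ℚ.- ℕtoℚ b) (ℕP.m∸n+n≡m b≤a) ⟩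
  ℕtoℚ a ℚ.- ℕtoℚ b                      ∎
  where open ≡-Reasoning

ℕtoℚ-nonNeg : ∀ m → ℚ.NonNegative (ℕtoℚ m)
ℕtoℚ-nonNeg m rewrite ℕtoℚ≡mkℚ m = _

invℕ-nonNeg : ∀ m → ℚ.NonNegative (invℕ m)
invℕ-nonNeg zero    = _
invℕ-nonNeg (suc m) = ℚP.normalize-nonNeg 1 (suc m)

invℕ-inverseˡ : ∀ m → 0 < m → invℕ m ℚ.* ℕtoℚ m ≡ 1ℚ
invℕ-inverseˡ (suc m) _
  rewrite ℚP.normalize-coprime {1} {m} (1-coprimeTo (suc m)) | ℕtoℚ≡mkℚ (suc m) =
  ℚP.*-inverseˡ (mkℚ (+ suc m) 0 (coprime-sym (1-coprimeTo (suc m))))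

*≡1⇒≡invℚ : ∀ x y → x ℚ.* y ≡ 1ℚ → x ≡ invℚ y
*≡1⇒≡invℚ x y xy with y ℚP.≟ 0ℚ
... | yes refl = ⊥-elim (1≢0 (trans (sym xy) (ℚP.*-zeroʳ x)))
  where
  1≢0 : 1ℚ ≢ 0ℚ
  1≢0 ()
... | no y≢0 = begin
  x                    ≡⟨ sym (ℚP.*-identityʳ x) ⟩
  x ℚ.* 1ℚ             ≡⟨ cong (x ℚ.*_) (sym (ℚP.*-inverseʳ y)) ⟩
  x ℚ.* (y ℚ.* 1/ y)   ≡⟨ sym (ℚP.*-assoc x y _) ⟩
  (x ℚ.* y) ℚ.* 1/ y   ≡⟨ cong (ℚ._* 1/ y) xy ⟩
  1ℚ ℚ.* 1/ y          ≡⟨ ℚP.*-identityˡ _ ⟩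
  1/ y                 ∎
  where
  open ≡-Reasoning
  instance y-nonZero = ℚ.≢-nonZero y≢0

sumBelow-mono : ∀ K {f g : ℕ → ℚ} → (∀ k → k < K → f k ℚ.≤ g k) → sumBelow K f ℚ.≤ sumBelow K g
sumBelow-mono zero    f≤g = ℚP.≤-refl
sumBelow-mono (suc K) f≤g =
  ℚP.+-mono-≤ (sumBelow-mono K (λ k k<K → f≤g k (ℕP.m≤n⇒m≤1+n k<K))) (f≤g K ℕP.≤-refl)

sumBelow-mono-except : ∀ K {f g : ℕ → ℚ} {p δ} → p < K →
  (∀ k → k < K → k ≢ p → f k ℚ.≤ g k) → f p ℚ.≤ g p ℚ.+ δ →
  sumBelow K f ℚ.≤ sumBelow K g ℚ.+ δ
sumBelow-mono-except (suc K) {f} {g} {p} {δ} p<1+K f≤g fp≤gp+δ with p ℕ.≟ K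
... | yes refl = ℚP.≤-trans
  (ℚP.+-mono-≤ (sumBelow-mono K (λ k k<K → f≤g k (ℕP.m≤n⇒m≤1+n k<K) (ℕP.<⇒≢ k<K))) fp≤gp+δ)
  (ℚP.≤-reflexive (sym (ℚP.+-assoc (sumBelow K g) (g K) δ)))
... | no p≢K = ℚP.≤-trans
  (ℚP.+-mono-≤
    (sumBelow-mono-except K (ℕP.≤∧≢⇒< (ℕP.≤-pred p<1+K) p≢K)
       (λ k k<K → f≤g k (ℕP.m≤n⇒m≤1+n k<K)) fp≤gp+δ)
    (f≤g K ℕP.≤-refl (p≢K ∘ sym)))
  (ℚP.≤-reflexive (solve 3 (λ a b c → a :+ c :+ b := a :+ b :+ c) refl (sumBelow K g) (g K) δ))

sumBelow-monoˡ : ∀ {f : ℕ → ℚ} → (∀ j → 0ℚ ℚ.≤ f j) → ∀ {a b} → a ≤ b → sumBelow a f ℚ.≤ sumBelow b f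
sumBelow-monoˡ {f} f≥0 a≤b = go (ℕP.≤⇒≤′ a≤b)
  where
  go : ∀ {a b} → a ℕ.≤′ b → sumBelow a f ℚ.≤ sumBelow b f
  go ℕ.≤′-refl          = ℚP.≤-refl
  go (ℕ.≤′-step {b} a≤b) = ℚP.≤-trans (go a≤b)
    (ℚP.≤-trans (ℚP.≤-reflexive (sym (ℚP.+-identityʳ _))) (ℚP.+-monoʳ-≤ (sumBelow b f) (f≥0 b)))

sumℚ : List ℚ → ℚ
sumℚ = foldr ℚ._+_ 0ℚ

sumℚ-map-allFin : ∀ {m} (g : Fin m → ℚ) → sumℚ (map g (allFin m)) ≡ sumℚ (tabulate g)
sumℚ-map-allFin {m} g = cong sumℚ (ListP.map-tabulate {n = m} (λ r → r) g)

sumℚ-tabulate-zero : ∀ {m} (g : Fin m → ℚ) → (∀ j → g j ≡ 0ℚ) → sumℚ (tabulate g) ≡ 0ℚ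
sumℚ-tabulate-zero {zero}  g g≡0 = refl
sumℚ-tabulate-zero {suc m} g g≡0 =
  cong₂ ℚ._+_ (g≡0 Fin.zero) (sumℚ-tabulate-zero (λ j → g (Fin.suc j)) (λ j → g≡0 (Fin.suc j)))

sumℚ-tabulate-single : ∀ {m} (g : Fin m → ℚ) (v : Fin m) → (∀ j → j ≢ v → g j ≡ 0ℚ) →
  sumℚ (tabulate g) ≡ g v
sumℚ-tabulate-single g Fin.zero    g≡0 = trans
  (cong (g Fin.zero ℚ.+_) (sumℚ-tabulate-zero _ (λ j → g≡0 (Fin.suc j) (λ ()))))
  (ℚP.+-identityʳ _)
sumℚ-tabulate-single g (Fin.suc v) g≡0 = trans
  (cong₂ ℚ._+_ (g≡0 Fin.zero (λ ()))
               (sumℚ-tabulate-single (λ j → g (Fin.suc j)) v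
                  (λ j j≢v → g≡0 (Fin.suc j) (j≢v ∘ FinP.suc-injective))))
  (ℚP.+-identityˡ _)

sumℚ-tabulate-indicator : ∀ {m} (P : Subset m) x →
  sumℚ (tabulate (λ r → if vlookup P r then x else 0ℚ)) ≡ ℕtoℚ ∣ P ∣ ℚ.* x
sumℚ-tabulate-indicator []            x = sym (ℚP.*-zeroˡ x)
sumℚ-tabulate-indicator (false ∷ P) x = trans (ℚP.+-identityˡ _) (sumℚ-tabulate-indicator P x)
sumℚ-tabulate-indicator (true ∷ P)  x = begin
  x ℚ.+ sumℚ (tabulate (λ r → if vlookup P r then x else 0ℚ))
    ≡⟨ cong (x ℚ.+_) (sumℚ-tabulate-indicator P x) ⟩
  x ℚ.+ ℕtoℚ ∣ P ∣ ℚ.* x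
    ≡⟨ solve 2 (λ a b → b :+ a :* b := (con 1ℚ :+ a) :* b) refl (ℕtoℚ ∣ P ∣) x ⟩
  (1ℚ ℚ.+ ℕtoℚ ∣ P ∣) ℚ.* x
    ≡⟨ cong (ℚ._* x) (sym (ℕtoℚ-+ 1 ∣ P ∣)) ⟩
  ℕtoℚ (suc ∣ P ∣) ℚ.* x
    ∎
  where open ≡-Reasoning

module _ (n : ℕ) where

  Zterm : (w m k : ℕ) → ℚ
  Zterm w m k = (ℕtoℚ w ℚ.- ℕtoℚ 2 ℚ.* d n k m) ℚ.* invℕ (4 * h n * 2 ^ k)

  αAt : (k m : ℕ) → ℚ
  αAt k m = (ℕtoℚ (2 ^ k) ℚ.- ℕtoℚ m) ℚ.* invℕ (h n * 2 ^ k)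

  αAt-complement : ∀ {k m} → m ≤ 2 ^ k → αAt k m ≡ ℕtoℚ (2 ^ k ∸ m) ℚ.* invℕ (h n * 2 ^ k)
  αAt-complement {k} m≤2^k = cong (ℚ._* invℕ (h n * 2 ^ k)) (sym (ℕtoℚ-∸ m≤2^k))

  αAt≢0 : ∀ {k m} → 0 < h n → m < 2 ^ k → αAt k m ≢ 0ℚ
  αAt≢0 {k} {m} h>0 m<2^k αAt≡0 =
    ℕP.<⇒≢ (ℕP.m<n⇒0<n∸m m<2^k) (sym (ℕtoℚ-injective {2 ^ k ∸ m} {0} (begin
      G                            ≡⟨ sym (ℚP.*-identityʳ G) ⟩
      G ℚ.* 1ℚ                     ≡⟨ cong (G ℚ.*_) (sym (invℕ-inverseˡ H H>0)) ⟩
      G ℚ.* (invℕ H ℚ.* ℕtoℚ H)    ≡⟨ sym (ℚP.*-assoc G (invℕ H) (ℕtoℚ H)) ⟩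
      G ℚ.* invℕ H ℚ.* ℕtoℚ H      ≡⟨ cong (ℚ._* ℕtoℚ H) (trans (sym (αAt-complement {k} (ℕP.<⇒≤ m<2^k))) αAt≡0) ⟩
      0ℚ ℚ.* ℕtoℚ H                ≡⟨ ℚP.*-zeroˡ (ℕtoℚ H) ⟩
      ℕtoℚ 0                       ∎)))
    where
    open ≡-Reasoning
    G = ℕtoℚ (2 ^ k ∸ m)
    H = h n * 2 ^ k
    H>0 = ℕP.*-mono-≤ h>0 (ℕP.m^n>0 2 k)

  d-mono : ∀ k {a b} → a ≤ b → d n k a ℚ.≤ d n k b
  d-mono k a≤b = ℚP.*-monoˡ-≤-nonNeg (ℕtoℚ (h n)) {{ℕtoℚ-nonNeg (h n)}}
    (sumBelow-monoˡ (λ j → ℚP.nonNegative⁻¹ _ {{summand-nonNeg j}}) a≤b)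
    where
    summand-nonNeg : ∀ j → ℚ.NonNegative (ℕtoℚ (2 ^ k) ℚ.* invℕ (suc (2 ^ k ∸ suc j)))
    summand-nonNeg j = ℚP.nonNeg*nonNeg⇒nonNeg (ℕtoℚ (2 ^ k)) {{ℕtoℚ-nonNeg (2 ^ k)}}
      (invℕ (suc (2 ^ k ∸ suc j))) {{invℕ-nonNeg (suc (2 ^ k ∸ suc j))}}

  Zterm-antitone : ∀ w k {a b} → a ≤ b → Zterm w b k ℚ.≤ Zterm w a k
  Zterm-antitone w k a≤b = ℚP.*-monoʳ-≤-nonNeg _ {{invℕ-nonNeg (4 * h n * 2 ^ k)}}
    (ℚP.+-monoʳ-≤ (ℕtoℚ w) (ℚP.neg-antimono-≤
      (ℚP.*-monoˡ-≤-nonNeg (ℕtoℚ 2) {{ℕtoℚ-nonNeg 2}} (d-mono k a≤b))))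

  Zterm-suc-w : ∀ w m k → Zterm (suc w) m k ≡ Zterm w m k ℚ.+ invℕ (4 * h n * 2 ^ k)
  Zterm-suc-w w m k rewrite ℕtoℚ-+ 1 w =
    solve 3 (λ W D I → (con 1ℚ :+ W :- D) :* I := (W :- D) :* I :+ I) refl
      (ℕtoℚ w) (ℕtoℚ 2 ℚ.* d n k m) (invℕ (4 * h n * 2 ^ k))

  d-suc : ∀ k m → d n k (suc m) ≡ d n k m ℚ.+ ℕtoℚ (h n) ℚ.* (ℕtoℚ (2 ^ k) ℚ.* invℕ (suc (2 ^ k ∸ suc m)))
  d-suc k m = ℚP.*-distribˡ-+ (ℕtoℚ (h n)) _ _

  c-decrement : (k m : ℕ) → ℚ
  c-decrement k m =
    ℕtoℚ 2 ℚ.* ℕtoℚ (h n) ℚ.* ℕtoℚ (2 ^ k) ℚ.* invℕ (suc (2 ^ k ∸ suc m)) ℚ.* invℕ (4 * h n * 2 ^ k)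

  Zterm-suc-c′ : ∀ w k m → Zterm w (suc m) k ≡ Zterm w m k ℚ.- c-decrement k m
  Zterm-suc-c′ w k m = begin
    Zterm w (suc m) k                                              ≡⟨ cong (λ x → (ℕtoℚ w ℚ.- two ℚ.* x) ℚ.* i4) (d-suc k m) ⟩
    (ℕtoℚ w ℚ.- two ℚ.* (d n k m ℚ.+ hq ℚ.* (Pq ℚ.* iM))) ℚ.* i4
      ≡⟨ solve 7 (λ W two D hq Pq iM i4 →
           (W :- two :* (D :+ hq :* (Pq :* iM))) :* i4 := (W :- two :* D) :* i4 :- two :* hq :* Pq :* iM :* i4)
           refl (ℕtoℚ w) two (d n k m) hq Pq iM i4 ⟩
    Zterm w m k ℚ.- c-decrement k m                                ∎
    where
    open ≡-Reasoning
    two = ℕtoℚ 2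
    hq  = ℕtoℚ (h n)
    Pq  = ℕtoℚ (2 ^ k)
    iM  = invℕ (suc (2 ^ k ∸ suc m))
    i4  = invℕ (4 * h n * 2 ^ k)

  -- Both sides equal 1 / (2 (2^k - m)).
  c-decrement≡invℚ : ∀ {k m} → 0 < h n → m < 2 ^ k →
    c-decrement k m ≡ invℚ (ℕtoℚ (2 * h n * 2 ^ k) ℚ.* αAt k m)
  c-decrement≡invℚ {k} {m} h>0 m<2^k = *≡1⇒≡invℚ (c-decrement k m) _ (begin
    c-decrement k m ℚ.* (ℕtoℚ (2 * h n * 2 ^ k) ℚ.* αAt k m)
      ≡⟨ cong₂ (λ x y → c-decrement k m ℚ.* (x ℚ.* y)) 2HP≡
           (trans (αAt-complement {k} (ℕP.<⇒≤ m<2^k)) (cong (λ x → ℕtoℚ x ℚ.* iH) (sym M≡2^k∸m))) ⟩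
    c-decrement k m ℚ.* (two ℚ.* hq ℚ.* Pq ℚ.* (Mq ℚ.* iH))
      ≡⟨ solve 7 (λ two hq Pq iM i4 Mq iH →
           (two :* hq :* Pq :* iM :* i4) :* (two :* hq :* Pq :* (Mq :* iH))
           := (iM :* Mq) :* (i4 :* (two :* two :* hq :* Pq)) :* (iH :* (hq :* Pq)))
           refl two hq Pq iM i4 Mq iH ⟩
    (iM ℚ.* Mq) ℚ.* (i4 ℚ.* (two ℚ.* two ℚ.* hq ℚ.* Pq)) ℚ.* (iH ℚ.* (hq ℚ.* Pq))
      ≡⟨ cong₂ ℚ._*_ (cong₂ ℚ._*_ (invℕ-inverseˡ M (s≤s z≤n))
                                   (trans (cong (i4 ℚ.*_) (sym 4HP≡)) (invℕ-inverseˡ _ 4HP>0)))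
                     (trans (cong (iH ℚ.*_) (sym (ℕtoℚ-* (h n) (2 ^ k)))) (invℕ-inverseˡ _ HP>0)) ⟩
    1ℚ ℚ.* 1ℚ ℚ.* 1ℚ                                                ∎)
    where
    open ≡-Reasoning
    two = ℕtoℚ 2
    hq  = ℕtoℚ (h n)
    Pq  = ℕtoℚ (2 ^ k)
    M   = suc (2 ^ k ∸ suc m)
    Mq  = ℕtoℚ M
    iM  = invℕ M
    i4  = invℕ (4 * h n * 2 ^ k)
    iH  = invℕ (h n * 2 ^ k)
    HP>0 : 0 < h n * 2 ^ k
    HP>0 = ℕP.*-mono-≤ h>0 (ℕP.m^n>0 2 k)
    4HP>0 : 0 < 4 * h n * 2 ^ k
    4HP>0 = ℕP.*-mono-≤ (ℕP.*-mono-≤ {1} {4} (s≤s z≤n) h>0) (ℕP.m^n>0 2 k)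
    M≡2^k∸m : M ≡ 2 ^ k ∸ m
    M≡2^k∸m = sym (ℕP.+-∸-assoc 1 m<2^k)
    2HP≡ : ℕtoℚ (2 * h n * 2 ^ k) ≡ two ℚ.* hq ℚ.* Pq
    2HP≡ = trans (ℕtoℚ-* (2 * h n) (2 ^ k)) (cong (ℚ._* Pq) (ℕtoℚ-* 2 (h n)))
    4HP≡ : ℕtoℚ (4 * h n * 2 ^ k) ≡ two ℚ.* two ℚ.* hq ℚ.* Pq
    4HP≡ = trans (ℕtoℚ-* (4 * h n) (2 ^ k))
             (cong (ℚ._* Pq) (trans (ℕtoℚ-* 4 (h n)) (cong (ℚ._* hq) (ℕtoℚ-* 2 2))))

  Zterm-suc-c : ∀ w {k m} → 0 < h n → m < 2 ^ k →
    Zterm w (suc m) k ≡ Zterm w m k ℚ.- invℚ (ℕtoℚ (2 * h n * 2 ^ k) ℚ.* αAt k m)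
  Zterm-suc-c w {k} {m} h>0 m<2^k =
    trans (Zterm-suc-c′ w k m) (cong (λ x → Zterm w m k ℚ.- x) (c-decrement≡invℚ {k} h>0 m<2^k))

x∉p⇒∣p∣<∣p∪⁅x⁆∣ : ∀ {m} {p : Subset m} {x} → x ∉ p → ∣ p ∣ < ∣ p ∪ ⁅ x ⁆ ∣
x∉p⇒∣p∣<∣p∪⁅x⁆∣ {p = p} {x} x∉p = p⊂q⇒∣p∣<∣q∣ (p⊆p∪q ⁅ x ⁆ , x , x∈p∪q⁺ (inj₂ (x∈⁅x⁆ x)) , x∉p)

lookup-∁⇒∉ : ∀ {m} (p : Subset m) x → vlookup (∁ p) x ≡ true → x ∉ p
lookup-∁⇒∉ p x eq = x∈∁p⇒x∉p (lookup⇒[]= x (∁ p) eq)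

≢⇒≡ᵇ≡false : ∀ {a b} → a ≢ b → (a ℕ.≡ᵇ b) ≡ false
≢⇒≡ᵇ≡false {a} {b} = dec-false (a ℕ.≟ b)

≡ᵇ-refl : ∀ a → (a ℕ.≡ᵇ a) ≡ true
≡ᵇ-refl a = dec-true (a ℕ.≟ a) refl

minList-≤ : ∀ n {x} {xs : List ℕ} → x ∈ₗ xs → minList n xs ≤ x
minList-≤ n {xs = _ List.∷ List.[]}    (here refl) = ℕP.≤-refl
minList-≤ n {xs = x List.∷ _ List.∷ _} (here refl) = ℕP.m⊓n≤m x _
minList-≤ n {xs = x List.∷ _ List.∷ _} (there x∈) = ℕP.≤-trans (ℕP.m⊓n≤n x _) (minList-≤ n x∈)

freshColourAt : (p : ℕ) → Subset (2 ^ p) → (k : ℕ) → Fin (2 ^ k) → Bool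
freshColourAt p Cp k r with k ℕ.≟ p
... | yes refl = vlookup (∁ Cp) r
... | no _     = false

freshColourAt⇒<2^p : ∀ p (Cp : Subset (2 ^ p)) k r → freshColourAt p Cp k r ≡ true → ∣ Cp ∣ < 2 ^ p
freshColourAt⇒<2^p p Cp k r fresh with k ℕ.≟ p
... | yes refl = ℕP.<-≤-trans (x∉p⇒∣p∣<∣p∪⁅x⁆∣ (lookup-∁⇒∉ Cp r fresh)) (∣p∣≤n (Cp ∪ ⁅ r ⁆))

sumℚ-freshColourAt-hit : ∀ {p k} (Cp : Subset (2 ^ p)) x → k ≡ p →
  sumℚ (map (λ r → if freshColourAt p Cp k r then x else 0ℚ) (allFin (2 ^ k))) ≡ ℕtoℚ ∣ ∁ Cp ∣ ℚ.* x
sumℚ-freshColourAt-hit {p} {k} Cp x k≡p with k ℕ.≟ p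
... | yes refl = trans (sumℚ-map-allFin (λ r → if vlookup (∁ Cp) r then x else 0ℚ))
                       (sumℚ-tabulate-indicator (∁ Cp) x)
... | no k≢p   = ⊥-elim (k≢p k≡p)

sumℚ-freshColourAt-miss : ∀ {p k} (Cp : Subset (2 ^ p)) x → k ≢ p →
  sumℚ (map (λ r → if freshColourAt p Cp k r then x else 0ℚ) (allFin (2 ^ k))) ≡ 0ℚ
sumℚ-freshColourAt-miss {p} {k} Cp x k≢p with k ℕ.≟ p
... | yes k≡p = ⊥-elim (k≢p k≡p)
... | no _    = trans (sumℚ-map-allFin {2 ^ k} (λ _ → 0ℚ)) (sumℚ-tabulate-zero {2 ^ k} (λ _ → 0ℚ) (λ _ → refl))

module _ {n : ℕ} where

  addColour-mono : ∀ (C₀ : (k : ℕ) → Subset (2 ^ k)) k* r k → ∣ C₀ k ∣ ≤ ∣ addColour n C₀ k* r k ∣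
  addColour-mono C₀ k* r k with k ℕ.≟ k*
  ... | yes refl = ∣p∣≤∣p∪q∣ (C₀ k) ⁅ r ⁆
  ... | no _     = ℕP.≤-refl

  addColour-fresh : ∀ (C₀ : (k : ℕ) → Subset (2 ^ k)) p k r →
    freshColourAt p (C₀ p) k r ≡ true → ∣ C₀ p ∣ < ∣ addColour n C₀ k r p ∣
  addColour-fresh C₀ p k r fresh with k ℕ.≟ p
  ... | yes refl rewrite ℕP.≟-diag (refl {x = k}) = x∉p⇒∣p∣<∣p∪⁅x⁆∣ (lookup-∁⇒∉ (C₀ k) r fresh)

  freshEvent : (st : State n) (S : Hyperedge n) (i : Fin n) → Outcome n st S → Bool
  freshEvent st S i o@(_ , r) = freshColourAt (phase st i) (C st i (phase st i)) (kstar n st S o) r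

  module _ (st : State n) (S : Hyperedge n) (i : Fin n) where

    pS-≤ : vlookup S i ≡ true → pS n st S ≤ phase st i
    pS-≤ i∈S = minList-≤ n
      (∈-map⁺ (phase st) (∈-filter⁺ (λ x → T? (vlookup S x)) (∈-allFin i) (subst T (sym i∈S) _)))

    c-next-mono : ∀ o k → c n st i k ≤ c n (next n st S o) i k
    c-next-mono (j , r) k with vlookup S i
    ... | true  = addColour-mono (C st i) (pS n st S + toℕ j) r k
    ... | false = ℕP.≤-refl

    c-next-fresh : vlookup S i ≡ true → ∀ o → freshEvent st S i o ≡ true →
      c n st i (phase st i) < c n (next n st S o) i (phase st i)
    c-next-fresh i∈S (j , r) fresh rewrite i∈S = addColour-fresh (C st i) (phase st i) (pS n st S + toℕ j) r fresh

    w-next-outside : vlookup S i ≡ false → ∀ o k → w (next n st S o) i k ≡ w st i k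
    w-next-outside i∉S (j , r) k rewrite i∉S = refl

    w-next-late : (phase st i ℕ.<ᵇ pS n st S + h n) ≡ false → ∀ o k → w (next n st S o) i k ≡ w st i k
    w-next-late late (j , r) k rewrite late | ∧-zeroʳ (vlookup S i) = refl

    w-next-other : ∀ o k → k ≢ phase st i → w (next n st S o) i k ≡ w st i k
    w-next-other (j , r) k k≢p
      rewrite ≢⇒≡ᵇ≡false k≢p
            | ∧-zeroʳ (phase st i ℕ.<ᵇ pS n st S + h n) | ∧-zeroʳ (vlookup S i) = refl

    w-next-phase : vlookup S i ≡ true → (phase st i ℕ.<ᵇ pS n st S + h n) ≡ true →
      ∀ o → w (next n st S o) i (phase st i) ≡ suc (w st i (phase st i))
    w-next-phase i∈S early (j , r) rewrite i∈S | early | ≡ᵇ-refl (phase st i) = refl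

    private
      p  = phase st i
      p₀ = pS n st S
      Cp = C st i p

    α-complement : α n st i ≡ ℕtoℚ ∣ ∁ Cp ∣ ℚ.* invℕ (h n * 2 ^ p)
    α-complement = trans (αAt-complement n {p} (∣p∣≤n Cp))
      (cong (λ x → ℕtoℚ x ℚ.* invℕ (h n * 2 ^ p)) (sym (∣∁p∣≡n∸∣p∣ Cp)))

    Pr-freshEvent : p₀ ≤ p → p < p₀ + h n → Pr n st S (freshEvent st S i) ≡ α n st i
    Pr-freshEvent p₀≤p p<p₀+h = begin
      Pr n st S (freshEvent st S i)                      ≡⟨ sumℚ-map-allFin g ⟩
      sumℚ (tabulate g)                                  ≡⟨ sumℚ-tabulate-single g v g-miss ⟩
      g v                                                ≡⟨ sumℚ-freshColourAt-hit Cp _ kv≡p ⟩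
      ℕtoℚ ∣ ∁ Cp ∣ ℚ.* invℕ (h n * 2 ^ (p₀ + toℕ v))    ≡⟨ cong (λ k → ℕtoℚ ∣ ∁ Cp ∣ ℚ.* invℕ (h n * 2 ^ k)) kv≡p ⟩
      ℕtoℚ ∣ ∁ Cp ∣ ℚ.* invℕ (h n * 2 ^ p)               ≡⟨ sym α-complement ⟩
      α n st i                                           ∎
      where
      open ≡-Reasoning
      g : Fin (h n) → ℚ
      g j = sumℚ (map (λ r → if freshEvent st S i (j , r) then prob n st S (j , r) else 0ℚ)
                      (allFin (2 ^ (p₀ + toℕ j))))
      p∸p₀<h : p ∸ p₀ < h n
      p∸p₀<h = ℕP.<-≤-trans (ℕP.∸-monoˡ-< p<p₀+h p₀≤p) (ℕP.≤-reflexive (ℕP.m+n∸m≡n p₀ (h n)))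
      v = fromℕ< p∸p₀<h
      kv≡p : p₀ + toℕ v ≡ p
      kv≡p = trans (cong (λ x → p₀ + x) (FinP.toℕ-fromℕ< p∸p₀<h)) (ℕP.m+[n∸m]≡n p₀≤p)
      g-miss : ∀ j → j ≢ v → g j ≡ 0ℚ
      g-miss j j≢v = sumℚ-freshColourAt-miss Cp _ λ kj≡p →
        j≢v (FinP.toℕ-injective (ℕP.+-cancelˡ-≡ p₀ _ _ (trans kj≡p (sym kv≡p))))

    freshEvent⇒α≢0 : 0 < h n → ∀ o → freshEvent st S i o ≡ true → α n st i ≢ 0ℚ
    freshEvent⇒α≢0 h>0 o@(_ , r) fresh = αAt≢0 n {p} h>0 (freshColourAt⇒<2^p p Cp (kstar n st S o) r fresh)

    Zterm-next-≤ : ∀ o k → w (next n st S o) i k ≡ w st i k →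
      Zterm n (w (next n st S o) i k) (c n (next n st S o) i k) k ℚ.≤ Zterm n (w st i k) (c n st i k) k
    Zterm-next-≤ o k w≡ = subst (λ x → Zterm n x (c n (next n st S o) i k) k ℚ.≤ Zterm n (w st i k) (c n st i k) k)
      (sym w≡) (Zterm-antitone n (w st i k) k (c-next-mono o k))

    Zupto-next-≤ : ∀ K o → (∀ k → k < K → w (next n st S o) i k ≡ w st i k) →
      Zupto n K (next n st S o) i ℚ.≤ Zupto n K st i
    Zupto-next-≤ K o w≡ = sumBelow-mono K (λ k k<K → Zterm-next-≤ o k (w≡ k k<K))

    Zupto-next-≤-except-phase : ∀ K o {δ} → p < K →
      Zterm n (w (next n st S o) i p) (c n (next n st S o) i p) p ℚ.≤ Zterm n (w st i p) (c n st i p) p ℚ.+ δ →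
      Zupto n K (next n st S o) i ℚ.≤ Zupto n K st i ℚ.+ δ
    Zupto-next-≤-except-phase K o p<K bound =
      sumBelow-mono-except K p<K (λ k _ k≢p → Zterm-next-≤ o k (w-next-other o k k≢p)) bound

    module _ (i∈S : vlookup S i ≡ true) (early : (p ℕ.<ᵇ p₀ + h n) ≡ true) (o : Outcome n st S) where

      Zterm-next-phase-≤ : ∀ {m} → m ≤ c n (next n st S o) i p →
        Zterm n (w (next n st S o) i p) (c n (next n st S o) i p) p ℚ.≤ Zterm n (suc (w st i p)) m p
      Zterm-next-phase-≤ {m} m≤c′ =
        subst (λ x → Zterm n x (c n (next n st S o) i p) p ℚ.≤ Zterm n (suc (w st i p)) m p)
              (sym (w-next-phase i∈S early o)) (Zterm-antitone n (suc (w st i p)) p m≤c′)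

      Zterm-next-phase : Zterm n (w (next n st S o) i p) (c n (next n st S o) i p) p
                           ℚ.≤ Zterm n (w st i p) (c n st i p) p ℚ.+ invℕ (4 * h n * 2 ^ p)
      Zterm-next-phase = ℚP.≤-trans (Zterm-next-phase-≤ (c-next-mono o p))
                                    (ℚP.≤-reflexive (Zterm-suc-w n (w st i p) (c n st i p) p))

      Zterm-next-phase-fresh : 0 < h n → freshEvent st S i o ≡ true →
        Zterm n (w (next n st S o) i p) (c n (next n st S o) i p) p
          ℚ.≤ Zterm n (w st i p) (c n st i p) p
                ℚ.+ (invℕ (4 * h n * 2 ^ p) ℚ.- invℚ (ℕtoℚ (2 * h n * 2 ^ p) ℚ.* α n st i))
      Zterm-next-phase-fresh h>0 fresh =
        ℚP.≤-trans (Zterm-next-phase-≤ (c-next-fresh i∈S o fresh)) (ℚP.≤-reflexive (begin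
          Zterm n (suc (w st i p)) (suc (c n st i p)) p  ≡⟨ Zterm-suc-w n (w st i p) (suc (c n st i p)) p ⟩
          Zterm n (w st i p) (suc (c n st i p)) p ℚ.+ D  ≡⟨ cong (ℚ._+ D) (Zterm-suc-c n (w st i p) {p} h>0 c<2^p) ⟩
          Zterm n (w st i p) (c n st i p) p ℚ.- X ℚ.+ D  ≡⟨ solve 3 (λ z x y → z :- x :+ y := z :+ (y :- x)) refl
                                                             (Zterm n (w st i p) (c n st i p) p) X D ⟩
          Zterm n (w st i p) (c n st i p) p ℚ.+ (D ℚ.- X) ∎))
        where
        open ≡-Reasoning
        D = invℕ (4 * h n * 2 ^ p)
        X = invℚ (ℕtoℚ (2 * h n * 2 ^ p) ℚ.* α n st i)
        c<2^p : c n st i p < 2 ^ p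
        c<2^p = freshColourAt⇒<2^p p Cp (kstar n st S o) (proj₂ o) fresh

ZStepBound : (n : ℕ) (st : State n) (S : Hyperedge n) (i : Fin n) (K : ℕ) → Set
ZStepBound n st S i K =
  ((o : Outcome n st S) → Zupto n K (next n st S o) i ℚ.≤ Zupto n K st i)
  ⊎
  Σ (Outcome n st S → Bool) (λ A →
     (Pr n st S A ≡ α n st i)
     × ((α n st i ≡ 0ℚ) → (o : Outcome n st S) → A o ≡ false)
     × ((o : Outcome n st S) → A o ≡ false →
          Zupto n K (next n st S o) i ℚ.≤ Zupto n K st i ℚ.+ invℕ (4 * h n * 2 ^ phase st i))
     × ((o : Outcome n st S) → A o ≡ true →
          Zupto n K (next n st S o) i
            ℚ.≤ (Zupto n K st i ℚ.+ invℕ (4 * h n * 2 ^ phase st i))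
                ℚ.- invℚ (ℕtoℚ (2 * h n * 2 ^ phase st i) ℚ.* α n st i)))

Z-step-bound : ∀ {n} → 0 < h n → (st : State n) (S : Hyperedge n) (i : Fin n) (K : ℕ) → ZStepBound n st S i K
Z-step-bound {n} h>0 st S i K =
  by-cases (vlookup S i BoolP.≟ true) ((phase st i ℕ.<ᵇ pS n st S + h n) BoolP.≟ true) (phase st i ℕ.<? K)
  where
  p = phase st i
  D = invℕ (4 * h n * 2 ^ p)
  X = invℚ (ℕtoℚ (2 * h n * 2 ^ p) ℚ.* α n st i)
  by-cases : Dec (vlookup S i ≡ true) → Dec ((p ℕ.<ᵇ pS n st S + h n) ≡ true) → Dec (p < K) →
             ZStepBound n st S i K
  by-cases (no i∉S) _ _ =
    inj₁ λ o → Zupto-next-≤ st S i K o λ k _ → w-next-outside st S i (¬-not i∉S) o k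
  by-cases (yes _) (no late) _ =
    inj₁ λ o → Zupto-next-≤ st S i K o λ k _ → w-next-late st S i (¬-not late) o k
  -- The one counter that could grow, w_{i,p(i)}, lies beyond the truncation of Z_i.
  by-cases (yes _) (yes _) (no p≮K) =
    inj₁ λ o → Zupto-next-≤ st S i K o λ k k<K → w-next-other st S i o k λ k≡p → p≮K (subst (_< K) k≡p k<K)
  by-cases (yes i∈S) (yes early) (yes p<K) = inj₂
    ( freshEvent st S i
    , Pr-freshEvent st S i (pS-≤ st S i i∈S) (ℕP.<ᵇ⇒< p (pS n st S + h n) (subst T (sym early) _))
    , (λ α≡0 o → ¬-not λ fresh → freshEvent⇒α≢0 st S i h>0 o fresh α≡0)
    , (λ o _ → Zupto-next-≤-except-phase st S i K o p<K (Zterm-next-phase st S i i∈S early o))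
    , (λ o fresh → ℚP.≤-trans
         (Zupto-next-≤-except-phase st S i K o p<K (Zterm-next-phase-fresh st S i i∈S early o h>0 fresh))
         (ℚP.≤-reflexive (sym (ℚP.+-assoc (Zupto n K st i) D (ℚ.- X))))))

lemma12 : (n : ℕ) → 2 ≤ n →
          (E : List (Hyperedge n)) → All Nonempty E →
          (t : Fin (length E)) →
          (st : State n) → Reachable n (take (toℕ t) E) st →
          (i : Fin n) →
          ((o : Outcome n st (lookup E t)) →
             Zupto n (suc (toℕ t) + h n) (next n st (lookup E t) o) i
               ℚ.≤ Zupto n (suc (toℕ t) + h n) st i)
          ⊎
          Σ (Outcome n st (lookup E t) → Bool) (λ A →
             (Pr n st (lookup E t) A ≡ α n st i)
             × ((α n st i ≡ 0ℚ) → (o : Outcome n st (lookup E t)) → A o ≡ false)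
             × ((o : Outcome n st (lookup E t)) → A o ≡ false →
                  Zupto n (suc (toℕ t) + h n) (next n st (lookup E t) o) i
                    ℚ.≤ Zupto n (suc (toℕ t) + h n) st i
                        ℚ.+ invℕ (4 * h n * 2 ^ phase st i))
             × ((o : Outcome n st (lookup E t)) → A o ≡ true →
                  Zupto n (suc (toℕ t) + h n) (next n st (lookup E t) o) i
                    ℚ.≤ (Zupto n (suc (toℕ t) + h n) st i
                        ℚ.+ invℕ (4 * h n * 2 ^ phase st i))
                        ℚ.- invℚ (ℕtoℚ (2 * h n * 2 ^ phase st i) ℚ.* α n st i)))
-- The bound holds in every state.
lemma12 n 2≤n E _ t st _ i = Z-step-bound (⌈log₂⌉-mono-≤ 2≤n) st (lookup E t) i (suc (toℕ t) + h n)
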